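{- For an indeterminate $q$ and a positive integer $n$, $$\sum_{k=0}^n\binom{2n+1}{n-k}_q\left[\binom{2n}{n-k}_q-\binom{2n}{n-k-1}_q\right]q^{k(k+1)}=q^n\binom{2n}{n}_q^2.$$
   Context: $[n]_q=\frac{1-q^n}{1-q}$, $[n]_q!=\prod_{i=1}^n[i]_q$, and $\binom{n}{k}_q=\frac{[n]_q!}{[k]_q![n-k]_q!}$ for $0\le k\le n$, with $\binom{n}{k}_q=0$ if $k<0$ or $k>n$. -}

module Defs where

open import Level using (Level)
open import Data.Nat using (ℕ; zero; suc; _∸_) renaming (_*_ to _*ℕ_)
open import Algebra.Bundles using (CommutativeRing)

-- An identity holding for every commutative
-- ring R and every q ∈ R is exactly an identity in ℤ[q] (take R = ℤ[q],
-- q = the indeterminate), which is how "q an indeterminate" is rendered.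
module QBinomial {c ℓ : Level} (R : CommutativeRing c ℓ) where
  open CommutativeRing R

  pow : Carrier → ℕ → Carrier
  pow x zero    = 1#
  pow x (suc m) = x * pow x m

  -- Over ℤ[q] this is the polynomial [n]_q! / ([k]_q! [n-k]_q!).
  qbinom : Carrier → ℕ → ℕ → Carrier
  qbinom q n       zero    = 1#
  qbinom q zero    (suc k) = 0#
  qbinom q (suc n) (suc k) = qbinom q n k + pow q (suc k) * qbinom q n (suc k)

  -- qbinomPred q n j = [n choose j-1]_q, which is 0 when j = 0
  -- (the convention [n choose -1]_q = 0).
  qbinomPred : Carrier → ℕ → ℕ → Carrier
  qbinomPred q n zero    = 0#
  qbinomPred q n (suc j) = qbinom q n j

  sumTo : ℕ → (ℕ → Carrier) → Carrier
  sumTo zero    f = f 0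
  sumTo (suc n) f = sumTo n f + f (suc n)

  lhsTerm : Carrier → ℕ → ℕ → Carrier
  lhsTerm q n k =
    qbinom q (suc (2 *ℕ n)) (n ∸ k)
      * (qbinom q (2 *ℕ n) (n ∸ k) - qbinomPred q (2 *ℕ n) (n ∸ k))
      * pow q (k *ℕ suc k)

{-# OPTIONS --safe #-}
-- The two q-Pascal rules
--   [m+1, j] = [m, j-1] + q^j [m, j] = q^(m+1-j) [m, j-1] + [m, j]
-- expand the same factor, so [m+1, j] ([m, j] - [m, j-1]) = q^j [m, j]² - q^(m+1-j) [m, j-1]².
-- For m = 2n and j = n-k this says that the k-th summand is T k - T (k+1), where
-- T k = q^(k(k+1)+n-k) [2n, n-k]²; the last summand (k = n) is T n itself, so the sum
-- telescopes to T 0 = q^n [2n, n]².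
module Submission where

open import Defs
open import Level using (Level)
open import Data.Nat using (ℕ; zero; suc; _∸_; _<_; z<s; s≤s) renaming (_*_ to _*ℕ_; _+_ to _+ℕ_)
import Data.Nat.Properties as ℕₚ
open import Data.Nat.Tactic.RingSolver using (solve-∀)
open import Data.Product using (_,_)
open import Algebra.Bundles using (CommutativeRing)
import Algebra.Properties.AbelianGroup as AbelianGroupProperties
import Algebra.Properties.CommutativeSemigroup as CommutativeSemigroupProperties
import Algebra.Properties.Ring as RingProperties
import Algebra.Solver.Ring.NaturalCoefficients.Default as NaturalCoefficientsSolver
import Relation.Binary.PropositionalEquality as ≡
import Relation.Binary.Reasoning.Setoid as SetoidReasoning

module _ {r ℓ : Level} (R : CommutativeRing r ℓ) where
  open CommutativeRing R hiding (zero)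
  open QBinomial R
  open SetoidReasoning setoid
  open AbelianGroupProperties +-abelianGroup using (⁻¹-∙-comm; //-rightDividesˡ)
  open CommutativeSemigroupProperties +-commutativeSemigroup using (interchange)
  open RingProperties ring using (x[y-z]≈xy-xz; [y-z]x≈yx-zx; -0#≈0#)
  open NaturalCoefficientsSolver commutativeSemiring using (solve; _:=_; _:+_; _:*_; con)

  [x+z]-[y+z]≈x-y : ∀ x y z → (x + z) - (y + z) ≈ x - y
  [x+z]-[y+z]≈x-y x y z = begin
    (x + z) - (y + z)    ≈⟨ +-congˡ (⁻¹-∙-comm y z) ⟨
    (x + z) + (- y - z)  ≈⟨ interchange x z (- y) (- z) ⟩
    (x - y) + (z - z)    ≈⟨ +-congˡ (-‿inverseʳ z) ⟩
    (x - y) + 0#         ≈⟨ +-identityʳ (x - y) ⟩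
    x - y                ∎

  *-sub-by-two-decompositions : ∀ {c x y u v} → c ≈ y + u * x → c ≈ v * y + x →
                                c * (x - y) ≈ u * (x * x) - v * (y * y)
  *-sub-by-two-decompositions {c} {x} {y} {u} {v} c≈y+ux c≈vy+x = begin
    c * (x - y)                                    ≈⟨ x[y-z]≈xy-xz c x y ⟩
    c * x - c * y                                  ≈⟨ +-cong (*-congʳ c≈y+ux) (-‿cong (*-congʳ c≈vy+x)) ⟩
    (y + u * x) * x - (v * y + x) * y              ≈⟨ +-cong (expandˡ x y u) (-‿cong (expandʳ x y v)) ⟩
    (u * (x * x) + x * y) - (v * (y * y) + x * y)  ≈⟨ [x+z]-[y+z]≈x-y _ _ _ ⟩
    u * (x * x) - v * (y * y)                      ∎
    where
    expandˡ : ∀ x y u → (y + u * x) * x ≈ u * (x * x) + x * y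
    expandˡ = solve 3 (λ x y u → (y :+ u :* x) :* x := u :* (x :* x) :+ x :* y) refl
    expandʳ : ∀ x y v → (v * y + x) * y ≈ v * (y * y) + x * y
    expandʳ = solve 3 (λ x y v → (v :* y :+ x) :* y := v :* (y :* y) :+ x :* y) refl

  sumTo-+-telescoping : ∀ n {f g : ℕ → Carrier} → (∀ {k} → k < suc n → f k ≈ g k - g (suc k)) →
                        sumTo n f + g (suc n) ≈ g 0
  sumTo-+-telescoping zero    {f} {g} step = begin
    f 0 + g 1          ≈⟨ +-congʳ (step z<s) ⟩
    (g 0 - g 1) + g 1  ≈⟨ //-rightDividesˡ (g 1) (g 0) ⟩
    g 0                ∎
  sumTo-+-telescoping (suc n) {f} {g} step = begin
    (sumTo n f + f (suc n)) + g (suc (suc n))                      ≈⟨ +-assoc _ _ _ ⟩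
    sumTo n f + (f (suc n) + g (suc (suc n)))                      ≈⟨ +-congˡ (+-congʳ (step (ℕₚ.n<1+n (suc n)))) ⟩
    sumTo n f + ((g (suc n) - g (suc (suc n))) + g (suc (suc n)))  ≈⟨ +-congˡ (//-rightDividesˡ _ _) ⟩
    sumTo n f + g (suc n)
      ≈⟨ sumTo-+-telescoping n (λ k<1+n → step (ℕₚ.m<n⇒m<1+n k<1+n)) ⟩
    g 0                                                            ∎

  sumTo-telescoping : ∀ n {f g : ℕ → Carrier} → (∀ {k} → k < n → f k ≈ g k - g (suc k)) → f n ≈ g n →
                      sumTo n f ≈ g 0
  sumTo-telescoping zero    _    f0≈g0 = f0≈g0
  sumTo-telescoping (suc n) step fn≈gn = trans (+-congˡ fn≈gn) (sumTo-+-telescoping n step)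

  pow-+ : ∀ x m n → pow x (m +ℕ n) ≈ pow x m * pow x n
  pow-+ x zero    n = sym (*-identityˡ (pow x n))
  pow-+ x (suc m) n = trans (*-congˡ (pow-+ x m n)) (sym (*-assoc x (pow x m) (pow x n)))

  pow-merge : ∀ x a e y → pow x a * y * pow x e ≈ pow x (e +ℕ a) * y
  pow-merge x a e y = begin
    pow x a * y * pow x e    ≈⟨ *-comm _ _ ⟩
    pow x e * (pow x a * y)  ≈⟨ *-assoc _ _ _ ⟨
    pow x e * pow x a * y    ≈⟨ *-congʳ (pow-+ x e a) ⟨
    pow x (e +ℕ a) * y       ∎

  module _ (q : Carrier) where

    qbinom-above : ∀ {n k} → n < k → qbinom q n k ≈ 0#
    qbinom-above {zero}  {suc k} _         = refl
    qbinom-above {suc n} {suc k} (s≤s n<k) = begin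
      qbinom q n k + pow q (suc k) * qbinom q n (suc k)
        ≈⟨ +-cong (qbinom-above n<k) (*-congˡ (qbinom-above (ℕₚ.m<n⇒m<1+n n<k))) ⟩
      0# + pow q (suc k) * 0#                            ≈⟨ +-identityˡ _ ⟩
      pow q (suc k) * 0#                                 ≈⟨ zeroʳ _ ⟩
      0#                                                 ∎

    qbinom-pascalʳ : ∀ n i d → i +ℕ d ≡.≡ n →
                     qbinom q (suc n) (suc i) ≈ pow q d * qbinom q n i + qbinom q n (suc i)
    qbinom-pascalʳ zero    zero    .zero    ≡.refl = begin
      1# + (q * 1#) * 0#  ≈⟨ +-congˡ (zeroʳ _) ⟩
      1# + 0#             ≈⟨ +-congʳ (*-identityˡ 1#) ⟨
      1# * 1# + 0#        ∎
    qbinom-pascalʳ (suc n) zero    .(suc n) ≡.refl = begin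
      1# + (q * 1#) * qbinom q (suc n) 1                         ≈⟨ +-congˡ (*-congˡ (qbinom-pascalʳ n zero n ≡.refl)) ⟩
      1# + (q * 1#) * (pow q n * 1# + qbinom q n 1)              ≈⟨ rearrange q (pow q n) (qbinom q n 1) ⟩
      (q * pow q n) * 1# + (1# + (q * 1#) * qbinom q n 1)        ∎
      where
      rearrange : ∀ q p b → 1# + (q * 1#) * (p * 1# + b) ≈ (q * p) * 1# + (1# + (q * 1#) * b)
      rearrange = solve 3 (λ q p b → con 1 :+ (q :* con 1) :* (p :* con 1 :+ b)
                                   := (q :* p) :* con 1 :+ (con 1 :+ (q :* con 1) :* b)) refl
    qbinom-pascalʳ n       (suc i) zero     ≡.refl = begin
      qbinom q n (suc i) + pow q (suc (suc i)) * qbinom q n (suc (suc i))  ≈⟨ +-congˡ (*-congˡ [n,2+i]≈0) ⟩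
      qbinom q n (suc i) + pow q (suc (suc i)) * 0#                        ≈⟨ +-congˡ (zeroʳ _) ⟩
      qbinom q n (suc i) + 0#                                              ≈⟨ +-cong (*-identityˡ _) [n,2+i]≈0 ⟨
      1# * qbinom q n (suc i) + qbinom q n (suc (suc i))                   ∎
      where
      [n,2+i]≈0 : qbinom q n (suc (suc i)) ≈ 0#
      [n,2+i]≈0 = qbinom-above (s≤s (s≤s (ℕₚ.≤-reflexive (ℕₚ.+-identityʳ i))))
    qbinom-pascalʳ (suc n) (suc i) (suc d) eq = begin
      qbinom q (suc n) (suc i) + pow q (suc (suc i)) * qbinom q (suc n) (suc (suc i))
        ≈⟨ +-cong (qbinom-pascalʳ n i (suc d) i+1+d≡n) (*-congˡ (qbinom-pascalʳ n (suc i) d 1+i+d≡n)) ⟩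
      (pow q (suc d) * a + b) + pow q (suc (suc i)) * (pow q d * b + c)
        ≈⟨ rearrange q (pow q d) (pow q (suc i)) a b c ⟩
      pow q (suc d) * (a + pow q (suc i) * b) + (b + pow q (suc (suc i)) * c)
        ∎
      where
      a b c : Carrier
      a = qbinom q n i
      b = qbinom q n (suc i)
      c = qbinom q n (suc (suc i))
      i+1+d≡n : i +ℕ suc d ≡.≡ n
      i+1+d≡n = ℕₚ.suc-injective eq
      1+i+d≡n : suc i +ℕ d ≡.≡ n
      1+i+d≡n = ≡.trans (≡.sym (ℕₚ.+-suc i d)) i+1+d≡n
      rearrange : ∀ q pd pi a b c →
                  ((q * pd) * a + b) + (q * pi) * (pd * b + c) ≈ (q * pd) * (a + pi * b) + (b + (q * pi) * c)
      rearrange = solve 6 (λ q pd pi a b c → ((q :* pd) :* a :+ b) :+ (q :* pi) :* (pd :* b :+ c)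
                                           := (q :* pd) :* (a :+ pi :* b) :+ (b :+ (q :* pi) :* c)) refl

    weightedSquare : ℕ → ℕ → ℕ → Carrier
    weightedSquare m a j = pow q a * (qbinom q m j * qbinom q m j)

    qbinom-suc-*-difference : ∀ m i d → i +ℕ d ≡.≡ m →
                              qbinom q (suc m) (suc i) * (qbinom q m (suc i) - qbinom q m i)
                                ≈ weightedSquare m (suc i) (suc i) - weightedSquare m d i
    qbinom-suc-*-difference m i d i+d≡m = *-sub-by-two-decompositions refl (qbinom-pascalʳ m i d i+d≡m)

    squareTerm : ℕ → ℕ → Carrier
    squareTerm N k = weightedSquare (2 *ℕ N) (k *ℕ suc k +ℕ (N ∸ k)) (N ∸ k)

    lhsTerm-telescopes : ∀ {N k} → k < N → lhsTerm q N k ≈ squareTerm N k - squareTerm N (suc k)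
    lhsTerm-telescopes {N} {k} k<N with i , ≡.refl ← ℕₚ.m≤n⇒∃[o]m+o≡n k<N = begin
      lhsTerm q N k
        ≡⟨ ≡.cong (λ j → qbinom q (suc m) j * (qbinom q m j - qbinomPred q m j) * pow q e) N∸k≡1+i ⟩
      qbinom q (suc m) (suc i) * (qbinom q m (suc i) - qbinom q m i) * pow q e
        ≈⟨ *-congʳ (qbinom-suc-*-difference m i d (i+d≡m k i)) ⟩
      (weightedSquare m (suc i) (suc i) - weightedSquare m d i) * pow q e
        ≈⟨ [y-z]x≈yx-zx (pow q e) _ _ ⟩
      weightedSquare m (suc i) (suc i) * pow q e - weightedSquare m d i * pow q e
        ≈⟨ +-cong (pow-merge q (suc i) e _) (-‿cong (pow-merge q d e _)) ⟩
      weightedSquare m (e +ℕ suc i) (suc i) - weightedSquare m (e +ℕ d) i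
        ≡⟨ ≡.cong (λ a → weightedSquare m (e +ℕ suc i) (suc i) - weightedSquare m a i) (e+d≡[k+1][k+2]+i k i) ⟩
      weightedSquare m (e +ℕ suc i) (suc i) - weightedSquare m (suc k *ℕ suc (suc k) +ℕ i) i
        ≡⟨ ≡.cong₂ (λ j j′ → weightedSquare m (e +ℕ j) j - weightedSquare m (suc k *ℕ suc (suc k) +ℕ j′) j′)
                   (≡.sym N∸k≡1+i) (≡.sym (ℕₚ.m+n∸m≡n k i)) ⟩
      squareTerm N k - squareTerm N (suc k)
        ∎
      where
      m e d : ℕ
      m = 2 *ℕ N
      e = k *ℕ suc k
      d = 2 *ℕ suc k +ℕ i
      N∸k≡1+i : N ∸ k ≡.≡ suc i
      N∸k≡1+i = ≡.trans (≡.cong (_∸ k) (≡.sym (ℕₚ.+-suc k i))) (ℕₚ.m+n∸m≡n k (suc i))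
      i+d≡m : ∀ k i → i +ℕ (2 *ℕ suc k +ℕ i) ≡.≡ 2 *ℕ suc (k +ℕ i)
      i+d≡m = solve-∀
      e+d≡[k+1][k+2]+i : ∀ k i → k *ℕ suc k +ℕ (2 *ℕ suc k +ℕ i) ≡.≡ suc k *ℕ suc (suc k) +ℕ i
      e+d≡[k+1][k+2]+i = solve-∀

    lhsTerm-last : ∀ N → lhsTerm q N N ≈ squareTerm N N
    lhsTerm-last N = begin
      lhsTerm q N N
        ≡⟨ ≡.cong (λ j → qbinom q (suc m) j * (qbinom q m j - qbinomPred q m j) * pow q e) (ℕₚ.n∸n≡0 N) ⟩
      1# * (1# - 0#) * pow q e     ≈⟨ *-congʳ (*-congˡ (trans (+-congˡ -0#≈0#) (+-identityʳ 1#))) ⟩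
      1# * 1# * pow q e            ≈⟨ *-comm _ _ ⟩
      weightedSquare m e 0         ≡⟨ ≡.cong (λ a → weightedSquare m a 0) (ℕₚ.+-identityʳ e) ⟨
      weightedSquare m (e +ℕ 0) 0  ≡⟨ ≡.cong (λ j → weightedSquare m (e +ℕ j) j) (ℕₚ.n∸n≡0 N) ⟨
      squareTerm N N               ∎
      where
      m e : ℕ
      m = 2 *ℕ N
      e = N *ℕ suc N

lemma3p1 : {c ℓ : Level} (R : CommutativeRing c ℓ) (q : CommutativeRing.Carrier R) (n : ℕ) →
           let open CommutativeRing R
               open QBinomial R
           in sumTo (suc n) (lhsTerm q (suc n)) ≈ pow q (suc n) * (qbinom q (2 *ℕ suc n) (suc n) * qbinom q (2 *ℕ suc n) (suc n))
lemma3p1 R q n = sumTo-telescoping R (suc n) (lhsTerm-telescopes R q) (lhsTerm-last R q (suc n))
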